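{- Let $G=(V,E)$ be a strongly biconnected directed graph and let $C_{2eb}\subseteq V$ be a $2$-edge-strongly-biconnected component of $G$. Then $C_{2eb}$ is a subset of some $2$-edge-biconnected block of $G$.
   Context: A directed graph is strongly biconnected if it is strongly connected and its underlying undirected graph is biconnected. For a directed graph $H$, a strongly biconnected component of $H$ is a maximal vertex subset $C$ such that the subgraph induced by $C$ is strongly biconnected. For an edge $b$, $G\setminus\{b\}=(V,E\setminus\{b\})$. In a strongly biconnected directed graph $G=(V,E)$, an edge $e$ is a b-bridge if $G\setminus\{e\}$ is not strongly biconnected; $G$ is $2$-edge-strongly-biconnected if $|V|>2$ and $G$ has no b-bridges. A $2$-edge-strongly-biconnected component of $G$ is a maximal vertex subset $C\subseteq V$ such that the induced subgraph $G[C]$ is $2$-edge-strongly-biconnected. For distinct $x,y\in V$, write $x \overset{e}{\leftrightsquigarrow} y$ if for every edge $b\in E$, the vertices $x,y$ belong to the same strongly biconnected component of $G\setminus\{b\}$. A $2$-edge-biconnected block of $G$ is a maximal vertex subset $U\subseteq V$ with $|U|>1$ such that $x \overset{e}{\leftrightsquigarrow} y$ for all distinct $x,y\in U$. -}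

module Defs where

open import Data.Nat using (ℕ; _<_)
open import Data.Fin using (Fin)
open import Data.Fin.Properties using (_≟_)
open import Data.Fin.Subset using (Subset; _∈_; _⊆_; _-_; ∣_∣)
open import Data.Bool using (Bool; true; false; _∧_; _∨_; not)
open import Data.Product using (_×_; ∃)
open import Relation.Binary.PropositionalEquality using (_≡_; _≢_)
open import Relation.Nullary.Decidable using (⌊_⌋)

Digraph : ℕ → Set
Digraph n = Fin n → Fin n → Bool

Edge : ∀ {n} → Digraph n → Fin n → Fin n → Set
Edge E x y = E x y ≡ true

removeEdge : ∀ {n} → Digraph n → Fin n → Fin n → Digraph n
removeEdge E u v x y = E x y ∧ not (⌊ x ≟ u ⌋ ∧ ⌊ y ≟ v ⌋)

undirected : ∀ {n} → Digraph n → Digraph n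
undirected E x y = E x y ∨ E y x

data Reach {n} (E : Digraph n) (C : Subset n) : Fin n → Fin n → Set where
  here : ∀ {x} → x ∈ C → Reach E C x x
  step : ∀ {x y z} → x ∈ C → Edge E x y → Reach E C y z → Reach E C x z

StronglyConnected : ∀ {n} → Digraph n → Subset n → Set
StronglyConnected E C = ∀ x y → x ∈ C → y ∈ C → Reach E C x y

UConnected : ∀ {n} → Digraph n → Subset n → Set
UConnected E C = StronglyConnected (undirected E) C

Biconnected : ∀ {n} → Digraph n → Subset n → Set
Biconnected E C = UConnected E C × (∀ v → v ∈ C → UConnected E (C - v))

StronglyBiconnected : ∀ {n} → Digraph n → Subset n → Set
StronglyBiconnected E C = StronglyConnected E C × Biconnected E C

SBComponent : ∀ {n} → Digraph n → Subset n → Set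
SBComponent E C =
  StronglyBiconnected E C × (∀ D → C ⊆ D → StronglyBiconnected E D → D ⊆ C)

-- E[C] is 2-edge-strongly-biconnected: strongly biconnected, |C| > 2,
-- and no edge of E[C] is a b-bridge of E[C].
TwoEdgeSB : ∀ {n} → Digraph n → Subset n → Set
TwoEdgeSB E C =
  StronglyBiconnected E C × 2 < ∣ C ∣ ×
  (∀ u v → u ∈ C → v ∈ C → Edge E u v →
     StronglyBiconnected (removeEdge E u v) C)

TwoEdgeSBComponent : ∀ {n} → Digraph n → Subset n → Set
TwoEdgeSBComponent E C =
  TwoEdgeSB E C × (∀ D → C ⊆ D → TwoEdgeSB E D → D ⊆ C)

TwoEdgeRel : ∀ {n} → Digraph n → Fin n → Fin n → Set
TwoEdgeRel E x y =
  ∀ u v → Edge E u v →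
    ∃ λ C → SBComponent (removeEdge E u v) C × x ∈ C × y ∈ C

BlockProp : ∀ {n} → Digraph n → Subset n → Set
BlockProp E U =
  1 < ∣ U ∣ × (∀ x y → x ∈ U → y ∈ U → x ≢ y → TwoEdgeRel E x y)

TwoEdgeBlock : ∀ {n} → Digraph n → Subset n → Set
TwoEdgeBlock E U = BlockProp E U × (∀ D → U ⊆ D → BlockProp E D → D ⊆ U)

-- Removing an edge b of G that does not lie inside C leaves the induced
-- subgraph G[C] unchanged, and removing one that does leaves it strongly
-- biconnected because C is 2-edge-strongly-biconnected. So C is strongly
-- biconnected in every G \ {b}, hence contained in a strongly biconnected
-- component of G \ {b}; thus all vertices of C are pairwise related by
-- ↭ᵉ, and since |C| > 2 the set C extends to a maximal such set, a block.
-- The maximal extensions exist constructively because every property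
-- involved is decidable, Fin n having finitely many subsets.
module Submission where

open import Defs
open import Data.Nat using (ℕ; zero; suc; _+_; _≤_; _<?_)
open import Data.Nat.Properties
  using (≤-trans; <-trans; <-≤-trans; ≤-pred; n<1+n; n≮0; m≤m+n; +-suc; +-monoʳ-≤; <⇒≱;
         module ≤-Reasoning)
open import Data.Fin.Properties using (_≟_; all?; any?)
open import Data.Fin.Subset
  using (Subset; ⊤; _⊆_; _⊂_; _∈_; _∉_; _-_; _─_; ⁅_⁆; ∣_∣; outside)
open import Data.Fin.Subset.Properties
  using (_∈?_; _⊂?_; _⊆?_; anySubset?; x∈⁅x⁆; p─q⊆p; x∈p∧x≢y⇒x∈p-y;
         x∈p⇒∣p-x∣<∣p∣; p⊂q⇒∣p∣<∣q∣; ∣p∣≤n)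
open import Data.Bool using (true; false; _∨_)
open import Data.Bool.Properties using (∨-zeroʳ) renaming (_≟_ to _≟ᵇ_)
open import Data.Product using (_×_; ∃; _,_; proj₁; proj₂)
open import Data.Sum using (_⊎_; inj₁; inj₂)
open import Data.Vec.Base using (_∷_; here; there)
open import Data.Empty using (⊥-elim)
open import Function using (_∘_)
open import Relation.Nullary using (¬_; Dec; yes; no)
open import Relation.Nullary.Decidable using (map′; decidable-stable; _×-dec_; _→-dec_; ¬?)
open import Relation.Unary using (Decidable)
open import Relation.Binary.PropositionalEquality using (_≡_; _≢_; refl; sym)

private variable
  n : ℕ

x∈p─q⇒x∉q : ∀ {p q : Subset n} {x} → x ∈ p ─ q → x ∉ q
x∈p─q⇒x∉q {p = _ ∷ _} {outside ∷ _} here ()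
x∈p─q⇒x∉q {p = _ ∷ _} {_ ∷ _} (there x∈p─q) (there x∈q) = x∈p─q⇒x∉q x∈p─q x∈q

∨≡true⇒⊎ : ∀ a b → a ∨ b ≡ true → a ≡ true ⊎ b ≡ true
∨≡true⇒⊎ true  _ _ = inj₁ refl
∨≡true⇒⊎ false _ e = inj₂ e

∨-introˡ : ∀ {a} b → a ≡ true → a ∨ b ≡ true
∨-introˡ _ refl = refl

∨-introʳ : ∀ a {b} → b ≡ true → a ∨ b ≡ true
∨-introʳ a refl = ∨-zeroʳ a

Maximal : (Subset n → Set) → Subset n → Set
Maximal P U = P U × (∀ D → U ⊆ D → P D → D ⊆ U)

allSubset? : ∀ {P : Subset n → Set} → Decidable P → Dec (∀ D → P D)
allSubset? P? = map′ (λ ¬∃¬P D → decidable-stable (P? D) (¬∃¬P ∘ (D ,_)))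
                     (λ ∀P (D , ¬PD) → ¬PD (∀P D))
                     (¬? (anySubset? (¬? ∘ P?)))

maximal? : ∀ {P : Subset n → Set} → Decidable P → Decidable (Maximal P)
maximal? P? U = P? U ×-dec allSubset? λ D → (U ⊆? D) →-dec P? D →-dec (D ⊆? U)

maximal-or-proper-extension : ∀ {P : Subset n → Set} → Decidable P → ∀ {C} → P C →
  Maximal P C ⊎ ∃ λ D → C ⊂ D × P D
maximal-or-proper-extension P? {C} PC with anySubset? (λ D → (C ⊂? D) ×-dec P? D)
... | yes ext   = inj₂ ext
... | no noExt  = inj₁ (PC , λ D C⊆D PD {x} x∈D →
  decidable-stable (x ∈? C) (λ x∉C → noExt (D , (C⊆D , x , x∈D , x∉C) , PD)))

-- Each proper extension raises ∣ C ∣, so k more steps suffice when n ≤ k + ∣ C ∣.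
maximal-extension-bounded : ∀ {P : Subset n → Set} → Decidable P →
  ∀ k C → n ≤ k + ∣ C ∣ → P C → ∃ λ U → Maximal P U × C ⊆ U
maximal-extension-bounded P? k C n≤k+∣C∣ PC with maximal-or-proper-extension P? PC
maximal-extension-bounded P? _ C _ _ | inj₁ maxC = C , maxC , λ x∈C → x∈C
maximal-extension-bounded P? zero C n≤∣C∣ _ | inj₂ (D , C⊂D , _) =
  ⊥-elim (<⇒≱ (p⊂q⇒∣p∣<∣q∣ C⊂D) (≤-trans (∣p∣≤n D) n≤∣C∣))
maximal-extension-bounded {n} P? (suc k) C n≤1+k+∣C∣ _ | inj₂ (D , C⊂D , PD) =
  let U , maxU , D⊆U = maximal-extension-bounded P? k D n≤k+∣D∣ PD
  in U , maxU , D⊆U ∘ proj₁ C⊂D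
  where
  open ≤-Reasoning
  n≤k+∣D∣ : n ≤ k + ∣ D ∣
  n≤k+∣D∣ = begin
    n               ≤⟨ n≤1+k+∣C∣ ⟩
    suc k + ∣ C ∣   ≡⟨ +-suc k ∣ C ∣ ⟨
    k + suc ∣ C ∣   ≤⟨ +-monoʳ-≤ k (p⊂q⇒∣p∣<∣q∣ C⊂D) ⟩
    k + ∣ D ∣       ∎

maximal-extension : ∀ {P : Subset n → Set} → Decidable P →
  ∀ {C} → P C → ∃ λ U → Maximal P U × C ⊆ U
maximal-extension {n} P? {C} = maximal-extension-bounded P? n C (m≤m+n n ∣ C ∣)

reach-source : ∀ {E : Digraph n} {C x y} → Reach E C x y → x ∈ C
reach-source (here x∈C)     = x∈C
reach-source (step x∈C _ _) = x∈C

reach-mono : ∀ {E : Digraph n} {C D x y} → C ⊆ D → Reach E C x y → Reach E D x y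
reach-mono C⊆D (here x∈C)       = here (C⊆D x∈C)
reach-mono C⊆D (step x∈C e xy)  = step (C⊆D x∈C) e (reach-mono C⊆D xy)

SubgraphOn : Subset n → Digraph n → Digraph n → Set
SubgraphOn S F G = ∀ {x y} → x ∈ S → y ∈ S → Edge F x y → Edge G x y

subgraphOn-mono : ∀ {S T} {F G : Digraph n} → T ⊆ S → SubgraphOn S F G → SubgraphOn T F G
subgraphOn-mono T⊆S F⊑G x∈T y∈T = F⊑G (T⊆S x∈T) (T⊆S y∈T)

subgraphOn-undirected : ∀ {S} {F G : Digraph n} →
  SubgraphOn S F G → SubgraphOn S (undirected F) (undirected G)
subgraphOn-undirected {F = F} {G} F⊑G {x} {y} x∈S y∈S e with ∨≡true⇒⊎ (F x y) (F y x) e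
... | inj₁ xy = ∨-introˡ (G y x) (F⊑G x∈S y∈S xy)
... | inj₂ yx = ∨-introʳ (G x y) (F⊑G y∈S x∈S yx)

reach-subgraphOn : ∀ {S} {F G : Digraph n} {x y} →
  SubgraphOn S F G → Reach F S x y → Reach G S x y
reach-subgraphOn F⊑G (here x∈S)      = here x∈S
reach-subgraphOn F⊑G (step x∈S e zy) =
  step x∈S (F⊑G x∈S (reach-source zy) e) (reach-subgraphOn F⊑G zy)

stronglyBiconnected-subgraphOn : ∀ {C} {F G : Digraph n} →
  SubgraphOn C F G → StronglyBiconnected F C → StronglyBiconnected G C
stronglyBiconnected-subgraphOn {C = C} {F} {G} F⊑G (strong , connected , noCut) =
  (λ x y x∈C y∈C → reach-subgraphOn F⊑G (strong x y x∈C y∈C)) ,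
  (λ x y x∈C y∈C → reach-subgraphOn F⊑Gᵘ (connected x y x∈C y∈C)) ,
  λ v v∈C x y x∈C y∈C →
    reach-subgraphOn (subgraphOn-mono (p─q⊆p C ⁅ v ⁆) F⊑Gᵘ) (noCut v v∈C x y x∈C y∈C)
  where
  F⊑Gᵘ : SubgraphOn C (undirected F) (undirected G)
  F⊑Gᵘ = subgraphOn-undirected F⊑G

removeEdge-outside : ∀ {E : Digraph n} {C u v} →
  ¬ (u ∈ C × v ∈ C) → SubgraphOn C E (removeEdge E u v)
removeEdge-outside {u = u} {v} uv⊈C {x} {y} x∈C y∈C e rewrite e with x ≟ u | y ≟ v
... | yes refl | yes refl = ⊥-elim (uv⊈C (x∈C , y∈C))
... | yes _    | no _     = refl
... | no _     | _        = refl

twoEdgeSB⇒stronglyBiconnected-removeEdge : ∀ {E : Digraph n} {C} → TwoEdgeSB E C →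
  ∀ u v → Edge E u v → StronglyBiconnected (removeEdge E u v) C
twoEdgeSB⇒stronglyBiconnected-removeEdge {E = E} {C} (sb , _ , noBridge) u v e
  with u ∈? C | v ∈? C
... | yes u∈C | yes v∈C = noBridge u v u∈C v∈C e
... | no u∉C  | _       =
  stronglyBiconnected-subgraphOn (removeEdge-outside {E = E} (u∉C ∘ proj₁)) sb
... | yes _   | no v∉C  =
  stronglyBiconnected-subgraphOn (removeEdge-outside {E = E} (v∉C ∘ proj₂)) sb

-- A path to y ≢ x either avoids x, or its part after the last visit of x does.
reach-split : ∀ {E : Digraph n} {C x w y} → y ≢ x → Reach E C w y →
  Reach E (C - x) w y ⊎ ∃ λ z → Edge E x z × Reach E (C - x) z y
reach-split y≢x (here y∈C) = inj₁ (here (x∈p∧x≢y⇒x∈p-y y∈C y≢x))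
reach-split {x = x} y≢x (step {x = w} {y = w′} w∈C e w′y) with reach-split y≢x w′y
... | inj₂ exit = inj₂ exit
... | inj₁ w′y-x with w ≟ x
...   | yes refl = inj₂ (w′ , e , w′y-x)
...   | no w≢x   = inj₁ (step (x∈p∧x≢y⇒x∈p-y w∈C w≢x) e w′y-x)

reach-first-step : ∀ {E : Digraph n} {C x y} → x ≢ y → Reach E C x y →
  ∃ λ z → Edge E x z × Reach E (C - x) z y
reach-first-step {x = x} x≢y xy with reach-split (x≢y ∘ sym) xy
... | inj₁ xy-x = ⊥-elim (x∈p─q⇒x∉q (reach-source xy-x) (x∈⁅x⁆ x))
... | inj₂ exit = exit

reach?-bounded : ∀ (E : Digraph n) k C → ∣ C ∣ ≤ k → ∀ x y → Dec (Reach E C x y)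
reach?-bounded E zero C ∣C∣≤0 x y =
  no λ xy → n≮0 (<-≤-trans (x∈p⇒∣p-x∣<∣p∣ (reach-source xy)) ∣C∣≤0)
reach?-bounded E (suc k) C ∣C∣≤1+k x y with x ∈? C | x ≟ y
... | no x∉C  | _        = no (x∉C ∘ reach-source)
... | yes x∈C | yes refl = yes (here x∈C)
... | yes x∈C | no x≢y   =
  map′ (λ (z , e , zy) → step x∈C e (reach-mono (p─q⊆p C ⁅ x ⁆) zy))
       (reach-first-step x≢y)
       (any? λ z → (E x z ≟ᵇ true) ×-dec reach?-bounded E k (C - x) ∣C-x∣≤k z y)
  where
  ∣C-x∣≤k : ∣ C - x ∣ ≤ k
  ∣C-x∣≤k = ≤-pred (<-≤-trans (x∈p⇒∣p-x∣<∣p∣ x∈C) ∣C∣≤1+k)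

reach? : ∀ (E : Digraph n) C x y → Dec (Reach E C x y)
reach? {n} E C = reach?-bounded E n C (∣p∣≤n C)

stronglyConnected? : ∀ (E : Digraph n) → Decidable (StronglyConnected E)
stronglyConnected? E C = all? λ x → all? λ y → (x ∈? C) →-dec (y ∈? C) →-dec reach? E C x y

stronglyBiconnected? : ∀ (E : Digraph n) → Decidable (StronglyBiconnected E)
stronglyBiconnected? E C =
  stronglyConnected? E C ×-dec stronglyConnected? (undirected E) C ×-dec
  all? λ v → (v ∈? C) →-dec stronglyConnected? (undirected E) (C - v)

twoEdgeSB⇒twoEdgeRel : ∀ {E : Digraph n} {C} → TwoEdgeSB E C →
  ∀ {x y} → x ∈ C → y ∈ C → TwoEdgeRel E x y
twoEdgeSB⇒twoEdgeRel {E = E} twoEdgeSB x∈C y∈C u v e =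
  let U , componentU , C⊆U = maximal-extension (stronglyBiconnected? (removeEdge E u v))
                               (twoEdgeSB⇒stronglyBiconnected-removeEdge twoEdgeSB u v e)
  in U , componentU , C⊆U x∈C , C⊆U y∈C

twoEdgeSB⇒blockProp : ∀ {E : Digraph n} {C} → TwoEdgeSB E C → BlockProp E C
twoEdgeSB⇒blockProp twoEdgeSB@(_ , 2<∣C∣ , _) =
  <-trans (n<1+n 1) 2<∣C∣ , λ _ _ x∈C y∈C _ → twoEdgeSB⇒twoEdgeRel twoEdgeSB x∈C y∈C

twoEdgeRel? : ∀ (E : Digraph n) x y → Dec (TwoEdgeRel E x y)
twoEdgeRel? E x y = all? λ u → all? λ v → (E u v ≟ᵇ true) →-dec
  anySubset? λ C →
    maximal? (stronglyBiconnected? (removeEdge E u v)) C ×-dec (x ∈? C) ×-dec (y ∈? C)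

blockProp? : ∀ (E : Digraph n) → Decidable (BlockProp E)
blockProp? E U = (1 <? ∣ U ∣) ×-dec all? λ x → all? λ y →
  (x ∈? U) →-dec (y ∈? U) →-dec ¬? (x ≟ y) →-dec twoEdgeRel? E x y

mainTheorem1 : ∀ (n : ℕ) (E : Digraph n) → StronglyBiconnected E ⊤ →
    ∀ (C : Subset n) → TwoEdgeSBComponent E C →
    ∃ λ U → TwoEdgeBlock E U × C ⊆ U
mainTheorem1 n E _ C (twoEdgeSB , _) =
  maximal-extension (blockProp? E) (twoEdgeSB⇒blockProp twoEdgeSB)
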